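{- There does not exist a polynomial-time computable (total) operator $F\colon\mathcal B\to\mathcal B$ such that for all $\varphi\in\mathcal B$ and all $n\in\omega$, \[ |F(\varphi)|(n)\ \ge\ |\varphi|(2n). \]
   Context: Alphabet $\Sigma=\{0,1,\#\}$; $\Sigma^*$ the set of finite strings, $|\mathtt a|$ the length of a string. The Baire space $\mathcal B$ is the set of all total functions $\varphi\colon\Sigma^*\to\Sigma^*$; its length is $|\varphi|\colon\omega\to\omega$, $|\varphi|(n)=\max\{|\varphi(\mathtt a)|:|\mathtt a|\le n\}$. Second-order polynomials $P(l,n)$ ($l\colon\omega\to\omega$, $n\in\omega$) are the smallest class containing $(l,n)\mapsto p(n)$ for integer polynomials $p$ with natural coefficients, closed under pointwise sum and product and under $P\mapsto (l,n)\mapsto l(P(l,n))$. Oracle Turing machines: an oracle query takes one time step and the oracle writes its answer onto the answer tape. $F\colon\mathcal B\to\mathcal B$ is polynomial-time computable if there are an oracle machine $M$ and a second-order polynomial $P$ such that for all $\varphi\in\mathcal B$ and strings $\mathtt a$, $M^\varphi(\mathtt a)$ halts within $P(|\varphi|,|\mathtt a|)$ steps with output $F(\varphi)(\mathtt a)$. -}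

module Defs where

open import Data.Nat using (ℕ; zero; suc; _+_; _*_; _⊔_; _≤_)
open import Data.List using (List; []; _∷_; map; concatMap; foldr; length; reverse; _++_; upTo)
open import Data.Maybe using (Maybe; just; nothing)
open import Data.Vec using (Vec; lookup; updateAt)
open import Data.Fin using (Fin; zero; suc)
open import Data.Product using (_×_; _,_; Σ; ∃)
open import Relation.Binary.PropositionalEquality using (_≡_)

data Sym : Set where
  s0 s1 s# : Sym

Str : Set
Str = List Sym

Baire : Set
Baire = Str → Str

wordsExact : ℕ → List Str
wordsExact zero    = [] ∷ []
wordsExact (suc n) = concatMap (λ w → (s0 ∷ w) ∷ (s1 ∷ w) ∷ (s# ∷ w) ∷ []) (wordsExact n)

wordsUpTo : ℕ → List Str
wordsUpTo n = concatMap wordsExact (upTo (suc n))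

maxList : List ℕ → ℕ
maxList = foldr _⊔_ 0

len : Baire → ℕ → ℕ
len φ n = maxList (map (λ a → length (φ a)) (wordsUpTo n))

data SOP : Set where
  poly : List ℕ → SOP          -- p(n) = c₀ + c₁ n + c₂ n² + …  (natural coefficients)
  _⊕_  : SOP → SOP → SOP
  _⊗_  : SOP → SOP → SOP
  app  : SOP → SOP

evalPoly : List ℕ → ℕ → ℕ
evalPoly []       n = 0
evalPoly (c ∷ cs) n = c + n * evalPoly cs n

evalSOP : SOP → (ℕ → ℕ) → ℕ → ℕ
evalSOP (poly cs) l n = evalPoly cs n
evalSOP (P ⊕ R)   l n = evalSOP P l n + evalSOP R l n
evalSOP (P ⊗ R)   l n = evalSOP P l n * evalSOP R l n
evalSOP (app P)   l n = l (evalSOP P l n)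

-- Oracle Turing machines
-- Tape cells hold Γ = Maybe Sym (nothing = blank). Tapes are one-way
-- infinite to the right; the head starts on the leftmost cell.

Γ : Set
Γ = Maybe Sym

record Tape : Set where
  constructor tape
  field
    left  : List Γ   -- cells left of the head, nearest first
    right : List Γ   -- head cell followed by the cells to its right ([] = blanks)

data Move : Set where
  L R S : Move

readT : Tape → Γ
readT (tape l [])      = nothing
readT (tape l (g ∷ r)) = g

writeT : Γ → Tape → Tape
writeT g (tape l [])      = tape l (g ∷ [])
writeT g (tape l (_ ∷ r)) = tape l (g ∷ r)

moveT : Move → Tape → Tape
moveT L (tape [] r)      = tape [] r
moveT L (tape (g ∷ l) r) = tape l (g ∷ r)
moveT R (tape l [])      = tape (nothing ∷ l) []
moveT R (tape l (g ∷ r)) = tape (g ∷ l) r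
moveT S t                = t

takeSyms : List Γ → Str
takeSyms []             = []
takeSyms (nothing ∷ _)  = []
takeSyms (just s ∷ gs)  = s ∷ takeSyms gs

contents : Tape → Str
contents (tape l r) = takeSyms (reverse l ++ r)

strTape : Str → Tape
strTape a = tape [] (map just a)

-- Tape layout (4 + k tapes): 0 = input, 1 = query, 2 = answer, 3 = output,
-- the remaining k are work tapes.
data Action (Q n : ℕ) : Set where
  step : Fin Q → Vec (Γ × Move) n → Action Q n
  ask  : Fin Q → Action Q n
  stop : Action Q n

record OTM : Set where
  field
    Q     : ℕ
    k     : ℕ
    start : Fin Q
    δ     : Fin Q → Vec Γ (4 + k) → Action Q (4 + k)

record Config (M : OTM) : Set where
  constructor conf
  field
    state : Fin (OTM.Q M)
    tapes : Vec Tape (4 + OTM.k M)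

initConf : (M : OTM) → Str → Config M
initConf M a = conf (OTM.start M) (updateAt (Data.Vec.replicate _ (tape [] [])) zero (λ _ → strTape a))

queryIx answerIx outputIx : ∀ {k} → Fin (4 + k)
queryIx  = suc zero
answerIx = suc (suc zero)
outputIx = suc (suc (suc zero))

-- Run for at most t steps (each transition, including an oracle query,
-- costs one step). Returns the output if the machine halts within t steps.
run : (M : OTM) → Baire → ℕ → Config M → Maybe Str
run M φ t (conf q ts) with OTM.δ M q (Data.Vec.map readT ts)
... | stop = just (contents (lookup ts outputIx))
run M φ zero    (conf q ts) | step _ _ = nothing
run M φ zero    (conf q ts) | ask _    = nothing
run M φ (suc t) (conf q ts) | step q′ acts =
  run M φ t (conf q′ (Data.Vec.zipWith (λ { (g , m) tp → moveT m (writeT g tp) }) acts ts))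
run M φ (suc t) (conf q ts) | ask q′ =
  run M φ t (conf q′ (updateAt ts answerIx (λ _ → strTape (φ (contents (lookup ts queryIx))))))

HaltsWithin : OTM → Baire → Str → ℕ → Str → Set
HaltsWithin M φ a t w = run M φ t (initConf M a) ≡ just w

PolyTimeComputable : (Baire → Baire) → Set
PolyTimeComputable F =
  Σ OTM λ M → Σ SOP λ P →
    (φ : Baire) (a : Str) → HaltsWithin M φ a (evalSOP P (len φ) (length a)) (F φ a)

module Submission where

-- Suppose an oracle machine M computes F within
-- the second-order polynomial time bound P.  Run M with the empty oracle ψ = λ _ → []
-- on every input of length ≤ n.  Since |ψ| ≡ 0, the bound P(|ψ|, ·) is an ordinary
-- polynomial c·(n+1)^d, so these runs ask at most (n+1)·3ⁿ·c·(n+1)^d queries in total,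
-- which is fewer than the 3^(2n) strings of length 2n once n is large.  Take an
-- unqueried string b of length 2n and let φ answer b with a string longer than
-- |F ψ|(n), and everything else with [].  On inputs of length ≤ n the machine cannot
-- tell φ from ψ, hence F φ and F ψ agree there and |F φ|(n) = |F ψ|(n) < |φ|(2n).

open import Defs
open import Data.Nat
open import Data.Nat.Properties
open import Data.Nat.Tactic.RingSolver using (solve-∀)
open import Data.List using (List; []; _∷_; _++_; length; map; concatMap; upTo; replicate)
open import Data.List.Properties using (length-upTo; length-replicate; length-++; ≡-dec; map-cong-local)
import Data.List.Relation.Unary.All as All
open import Data.List.Membership.Propositional using (_∈_; find; lose)
open import Data.List.Membership.Propositional.Properties
  using (∈-concatMap⁺; ∈-concatMap⁻; ∈-upTo⁺; ∈-upTo⁻; ∈-map⁺)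
open import Data.List.Relation.Unary.Any using (here; there)
open import Data.Maybe using (just)
open import Data.Maybe.Properties using (just-injective)
open import Data.Vec using (lookup; updateAt)
open import Data.Product using (Σ; _×_; _,_)
open import Data.Sum using (inj₁; inj₂)
open import Data.Empty using (⊥-elim)
open import Relation.Nullary using (¬_; Dec; yes; no; contradiction)
open import Relation.Binary.PropositionalEquality
open import Algebra.Properties.CommutativeSemigroup *-commutativeSemigroup using (interchange)

queries : (M : OTM) → Baire → ℕ → Config M → List Str
queries M φ t (conf q ts) with OTM.δ M q (Data.Vec.map readT ts)
... | stop = []
queries M φ zero    (conf q ts) | step _ _ = []
queries M φ zero    (conf q ts) | ask _    = []
queries M φ (suc t) (conf q ts) | step q′ acts =
  queries M φ t (conf q′ (Data.Vec.zipWith (λ { (g , m) tp → moveT m (writeT g tp) }) acts ts))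
queries M φ (suc t) (conf q ts) | ask q′ =
  contents (lookup ts queryIx) ∷
  queries M φ t (conf q′ (updateAt ts answerIx (λ _ → strTape (φ (contents (lookup ts queryIx))))))

-- Each query costs a step, so a run of t steps asks at most t queries.
queries-length : (M : OTM) (φ : Baire) (t : ℕ) (c : Config M) → length (queries M φ t c) ≤ t
queries-length M φ t (conf q ts) with OTM.δ M q (Data.Vec.map readT ts)
... | stop = z≤n
queries-length M φ zero    (conf q ts) | step _ _ = z≤n
queries-length M φ zero    (conf q ts) | ask _    = z≤n
queries-length M φ (suc t) (conf q ts) | step q′ acts = m≤n⇒m≤1+n (queries-length M φ t _)
queries-length M φ (suc t) (conf q ts) | ask q′       = s≤s (queries-length M φ t _)

run-agree : (M : OTM) (φ ψ : Baire) (t : ℕ) (c : Config M) →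
  (∀ {x} → x ∈ queries M ψ t c → φ x ≡ ψ x) → run M φ t c ≡ run M ψ t c
run-agree M φ ψ t (conf q ts) agree with OTM.δ M q (Data.Vec.map readT ts)
... | stop = refl
run-agree M φ ψ zero    (conf q ts) agree | step _ _ = refl
run-agree M φ ψ zero    (conf q ts) agree | ask _    = refl
run-agree M φ ψ (suc t) (conf q ts) agree | step q′ acts = run-agree M φ ψ t _ agree
run-agree M φ ψ (suc t) (conf q ts) agree | ask q′ rewrite agree (here refl) =
  run-agree M φ ψ t _ (λ x∈ → agree (there x∈))

run-mono : (M : OTM) (φ : Baire) (t t′ : ℕ) (c : Config M) {w : Str} → t ≤ t′ →
  run M φ t c ≡ just w → run M φ t′ c ≡ just w
run-mono M φ t t′ (conf q ts) t≤t′ halts with OTM.δ M q (Data.Vec.map readT ts)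
... | stop = halts
run-mono M φ zero t′ (conf q ts) t≤t′ () | step _ _
run-mono M φ zero t′ (conf q ts) t≤t′ () | ask _
run-mono M φ (suc t) (suc t′) (conf q ts) (s≤s t≤t′) halts | step q′ acts = run-mono M φ t t′ _ t≤t′ halts
run-mono M φ (suc t) (suc t′) (conf q ts) (s≤s t≤t′) halts | ask q′       = run-mono M φ t t′ _ t≤t′ halts

halts-unique : (M : OTM) (φ : Baire) (a : Str) {t t′ : ℕ} {w w′ : Str} →
  HaltsWithin M φ a t w → HaltsWithin M φ a t′ w′ → w ≡ w′
halts-unique M φ a {t} {t′} h h′ with ≤-total t t′
... | inj₁ t≤t′ = just-injective (trans (sym (run-mono M φ t t′ _ t≤t′ h)) h′)
... | inj₂ t′≤t = just-injective (trans (sym h) (run-mono M φ t′ t _ t′≤t h′))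

length-concatMap : {A B : Set} (f : A → List B) (xs : List A) (k : ℕ) →
  (∀ {x} → x ∈ xs → length (f x) ≤ k) → length (concatMap f xs) ≤ length xs * k
length-concatMap f []       k bound = z≤n
length-concatMap f (x ∷ xs) k bound = begin
  length (f x ++ concatMap f xs)       ≡⟨ length-++ (f x) ⟩
  length (f x) + length (concatMap f xs)
    ≤⟨ +-mono-≤ (bound (here refl)) (length-concatMap f xs k (λ x∈ → bound (there x∈))) ⟩
  k + length xs * k                    ∎
  where open ≤-Reasoning

extend : Str → List Str
extend w = (s0 ∷ w) ∷ (s1 ∷ w) ∷ (s# ∷ w) ∷ []

∈-concatMap : {A B : Set} (f : A → List B) {xs : List A} {x : A} {y : B} →
  x ∈ xs → y ∈ f x → y ∈ concatMap f xs
∈-concatMap f x∈ y∈ = ∈-concatMap⁺ f (lose x∈ y∈)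

∈-wordsExact : (b : Str) → b ∈ wordsExact (length b)
∈-wordsExact []       = here refl
∈-wordsExact (s0 ∷ b) = ∈-concatMap extend (∈-wordsExact b) (here refl)
∈-wordsExact (s1 ∷ b) = ∈-concatMap extend (∈-wordsExact b) (there (here refl))
∈-wordsExact (s# ∷ b) = ∈-concatMap extend (∈-wordsExact b) (there (there (here refl)))

wordsExact-length : (k : ℕ) {b : Str} → b ∈ wordsExact k → length b ≡ k
wordsExact-length zero    (here refl) = refl
wordsExact-length (suc k) b∈ with find (∈-concatMap⁻ extend {xs = wordsExact k} b∈)
... | w , w∈ , here refl                 = cong suc (wordsExact-length k w∈)
... | w , w∈ , there (here refl)         = cong suc (wordsExact-length k w∈)
... | w , w∈ , there (there (here refl)) = cong suc (wordsExact-length k w∈)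

∈-wordsUpTo : (n : ℕ) (b : Str) → length b ≤ n → b ∈ wordsUpTo n
∈-wordsUpTo n b ≤n = ∈-concatMap wordsExact (∈-upTo⁺ (s≤s ≤n)) (∈-wordsExact b)

wordsUpTo-length : (n : ℕ) {b : Str} → b ∈ wordsUpTo n → length b ≤ n
wordsUpTo-length n b∈ with find (∈-concatMap⁻ wordsExact {xs = upTo (suc n)} b∈)
... | k , k∈ , b∈k rewrite wordsExact-length k b∈k = ≤-pred (∈-upTo⁻ k∈)

wordsExact-size : (k : ℕ) → length (wordsExact k) ≤ 3 ^ k
wordsExact-size zero    = ≤-refl
wordsExact-size (suc k) = begin
  length (concatMap extend (wordsExact k)) ≤⟨ length-concatMap extend (wordsExact k) 3 (λ _ → ≤-refl) ⟩
  length (wordsExact k) * 3                ≤⟨ *-monoˡ-≤ 3 (wordsExact-size k) ⟩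
  3 ^ k * 3                                ≡⟨ *-comm (3 ^ k) 3 ⟩
  3 ^ suc k                                ∎
  where open ≤-Reasoning

wordsUpTo-size : (n : ℕ) → length (wordsUpTo n) ≤ suc n * 3 ^ n
wordsUpTo-size n = begin
  length (wordsUpTo n)           ≤⟨ length-concatMap wordsExact (upTo (suc n)) (3 ^ n) exact≤ ⟩
  length (upTo (suc n)) * 3 ^ n  ≡⟨ cong (_* 3 ^ n) (length-upTo (suc n)) ⟩
  suc n * 3 ^ n                  ∎
  where
  open ≤-Reasoning
  exact≤ : ∀ {k} → k ∈ upTo (suc n) → length (wordsExact k) ≤ 3 ^ n
  exact≤ {k} k∈ = ≤-trans (wordsExact-size k) (^-monoʳ-≤ 3 (≤-pred (∈-upTo⁻ k∈)))

maxList-≥ : {x : ℕ} (xs : List ℕ) → x ∈ xs → x ≤ maxList xs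
maxList-≥ (y ∷ xs) (here refl) = m≤m⊔n y (maxList xs)
maxList-≥ (y ∷ xs) (there x∈)  = ≤-trans (maxList-≥ xs x∈) (m≤n⊔m y (maxList xs))

len-≥ : (φ : Baire) (m : ℕ) (b : Str) → length b ≤ m → length (φ b) ≤ len φ m
len-≥ φ m b ≤m = maxList-≥ _ (∈-map⁺ (λ a → length (φ a)) (∈-wordsUpTo m b ≤m))

len-cong : (φ ψ : Baire) (n : ℕ) → (∀ a → length a ≤ n → φ a ≡ ψ a) → len φ n ≡ len ψ n
len-cong φ ψ n agree =
  cong maxList (map-cong-local (All.tabulate (λ a∈ → cong length (agree _ (wordsUpTo-length n a∈)))))

len-empty : (n : ℕ) → len (λ _ → []) n ≡ 0
len-empty n = maxList-zeros (wordsUpTo n)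
  where
  maxList-zeros : (xs : List Str) → maxList (map (λ _ → 0) xs) ≡ 0
  maxList-zeros []       = refl
  maxList-zeros (x ∷ xs) = maxList-zeros xs

tailsAfter : Sym → List Str → List Str
tailsAfter s  []                = []
tailsAfter s  ([] ∷ ys)         = tailsAfter s ys
tailsAfter s0 ((s0 ∷ xs) ∷ ys)  = xs ∷ tailsAfter s0 ys
tailsAfter s1 ((s1 ∷ xs) ∷ ys)  = xs ∷ tailsAfter s1 ys
tailsAfter s# ((s# ∷ xs) ∷ ys)  = xs ∷ tailsAfter s# ys
tailsAfter s  ((x ∷ xs) ∷ ys)   = tailsAfter s ys

tailsAfter-total : (ys : List Str) →
  length (tailsAfter s0 ys) + (length (tailsAfter s1 ys) + length (tailsAfter s# ys)) ≤ length ys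
tailsAfter-total []                = z≤n
tailsAfter-total ([] ∷ ys)         = m≤n⇒m≤1+n (tailsAfter-total ys)
tailsAfter-total ((s0 ∷ xs) ∷ ys)  = s≤s (tailsAfter-total ys)
tailsAfter-total ((s1 ∷ xs) ∷ ys)
  rewrite +-suc (length (tailsAfter s0 ys)) (length (tailsAfter s1 ys) + length (tailsAfter s# ys))
  = s≤s (tailsAfter-total ys)
tailsAfter-total ((s# ∷ xs) ∷ ys)
  rewrite +-suc (length (tailsAfter s1 ys)) (length (tailsAfter s# ys))
        | +-suc (length (tailsAfter s0 ys)) (length (tailsAfter s1 ys) + length (tailsAfter s# ys))
  = s≤s (tailsAfter-total ys)

tailsAfter-∷ : (s : Sym) (y : Str) (ys : List Str) {z : Str} → z ∈ tailsAfter s ys → z ∈ tailsAfter s (y ∷ ys)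
tailsAfter-∷ s  []        ys z∈ = z∈
tailsAfter-∷ s0 (s0 ∷ xs) ys z∈ = there z∈
tailsAfter-∷ s0 (s1 ∷ xs) ys z∈ = z∈
tailsAfter-∷ s0 (s# ∷ xs) ys z∈ = z∈
tailsAfter-∷ s1 (s0 ∷ xs) ys z∈ = z∈
tailsAfter-∷ s1 (s1 ∷ xs) ys z∈ = there z∈
tailsAfter-∷ s1 (s# ∷ xs) ys z∈ = z∈
tailsAfter-∷ s# (s0 ∷ xs) ys z∈ = z∈
tailsAfter-∷ s# (s1 ∷ xs) ys z∈ = z∈
tailsAfter-∷ s# (s# ∷ xs) ys z∈ = there z∈

∈-tailsAfter : (s : Sym) (ys : List Str) {xs : Str} → (s ∷ xs) ∈ ys → xs ∈ tailsAfter s ys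
∈-tailsAfter s0 (y ∷ ys) (here refl) = here refl
∈-tailsAfter s1 (y ∷ ys) (here refl) = here refl
∈-tailsAfter s# (y ∷ ys) (here refl) = here refl
∈-tailsAfter s  (y ∷ ys) (there s∷xs∈) = tailsAfter-∷ s y ys (∈-tailsAfter s ys s∷xs∈)

sparseHead : (m : ℕ) (ys : List Str) → length ys < 3 ^ suc m →
  Σ Sym λ s → length (tailsAfter s ys) < 3 ^ m
sparseHead m ys short with length (tailsAfter s0 ys) <? 3 ^ m
... | yes sparse = s0 , sparse
... | no dense₀ with length (tailsAfter s1 ys) <? 3 ^ m
...   | yes sparse = s1 , sparse
...   | no dense₁ with length (tailsAfter s# ys) <? 3 ^ m
...     | yes sparse = s# , sparse
...     | no dense₂ = contradiction (≤-trans covered (tailsAfter-total ys)) (<⇒≱ short)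
  where
  covered : 3 ^ suc m ≤ length (tailsAfter s0 ys) + (length (tailsAfter s1 ys) + length (tailsAfter s# ys))
  covered = +-mono-≤ (≮⇒≥ dense₀) (+-mono-≤ (≮⇒≥ dense₁) (≤-trans (≤-reflexive (+-identityʳ (3 ^ m))) (≮⇒≥ dense₂)))

-- A list of fewer than 3^m strings misses some string of length m.  By induction on m,
-- recursing into the tails after a first symbol with fewer than 3^m continuations.
avoid : (m : ℕ) (ys : List Str) → length ys < 3 ^ m → Σ Str λ b → length b ≡ m × ¬ b ∈ ys
avoid zero    []       short = [] , refl , λ ()
avoid zero    (y ∷ ys) (s≤s ())
avoid (suc m) ys       short with sparseHead m ys short
... | s , sparse with avoid m (tailsAfter s ys) sparse
...   | b , refl , b∉ = s ∷ b , refl , λ s∷b∈ → b∉ (∈-tailsAfter s ys s∷b∈)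

PolyBounded : (ℕ → ℕ) → Set
PolyBounded f = Σ ℕ λ c → Σ ℕ λ d → ∀ n → f n ≤ c * suc n ^ d

+-polyBounded : {f g : ℕ → ℕ} → PolyBounded f → PolyBounded g → PolyBounded (λ n → f n + g n)
+-polyBounded {f} {g} (c₁ , d₁ , f≤) (c₂ , d₂ , g≤) = c₁ + c₂ , d₁ + d₂ , λ n → begin
  f n + g n                                        ≤⟨ +-mono-≤ (f≤ n) (g≤ n) ⟩
  c₁ * suc n ^ d₁ + c₂ * suc n ^ d₂
    ≤⟨ +-mono-≤ (*-monoʳ-≤ c₁ (^-monoʳ-≤ (suc n) (m≤m+n d₁ d₂)))
                (*-monoʳ-≤ c₂ (^-monoʳ-≤ (suc n) (m≤n+m d₂ d₁))) ⟩
  c₁ * suc n ^ (d₁ + d₂) + c₂ * suc n ^ (d₁ + d₂)  ≡⟨ *-distribʳ-+ (suc n ^ (d₁ + d₂)) c₁ c₂ ⟨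
  (c₁ + c₂) * suc n ^ (d₁ + d₂)                    ∎
  where open ≤-Reasoning

*-polyBounded : {f g : ℕ → ℕ} → PolyBounded f → PolyBounded g → PolyBounded (λ n → f n * g n)
*-polyBounded {f} {g} (c₁ , d₁ , f≤) (c₂ , d₂ , g≤) = c₁ * c₂ , d₁ + d₂ , λ n → begin
  f n * g n                                    ≤⟨ *-mono-≤ (f≤ n) (g≤ n) ⟩
  (c₁ * suc n ^ d₁) * (c₂ * suc n ^ d₂)        ≡⟨ interchange c₁ _ c₂ _ ⟩
  (c₁ * c₂) * (suc n ^ d₁ * suc n ^ d₂)        ≡⟨ cong ((c₁ * c₂) *_) (^-distribˡ-+-* (suc n) d₁ d₂) ⟨
  (c₁ * c₂) * suc n ^ (d₁ + d₂)                ∎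
  where open ≤-Reasoning

const-polyBounded : {f : ℕ → ℕ} (K : ℕ) → (∀ n → f n ≤ K) → PolyBounded f
const-polyBounded K f≤K = K , 0 , λ n → ≤-trans (f≤K n) (≤-reflexive (sym (*-identityʳ K)))

id-polyBounded : PolyBounded (λ n → n)
id-polyBounded = 1 , 1 , λ n → ≤-trans (n≤1+n n) (≤-reflexive (sym (trans (*-identityˡ _) (*-identityʳ (suc n)))))

evalPoly-polyBounded : (cs : List ℕ) → PolyBounded (evalPoly cs)
evalPoly-polyBounded []       = const-polyBounded 0 (λ _ → z≤n)
evalPoly-polyBounded (c ∷ cs) =
  +-polyBounded (const-polyBounded c (λ _ → ≤-refl)) (*-polyBounded id-polyBounded (evalPoly-polyBounded cs))

-- At a bounded length function, a second-order polynomial is bounded by an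
-- ordinary polynomial: the application case l(P(l,n)) is at most the bound of l.
evalSOP-polyBounded : (P : SOP) (l : ℕ → ℕ) (K : ℕ) → (∀ x → l x ≤ K) → PolyBounded (evalSOP P l)
evalSOP-polyBounded (poly cs) l K l≤K = evalPoly-polyBounded cs
evalSOP-polyBounded (P ⊕ P′)  l K l≤K = +-polyBounded (evalSOP-polyBounded P l K l≤K) (evalSOP-polyBounded P′ l K l≤K)
evalSOP-polyBounded (P ⊗ P′)  l K l≤K = *-polyBounded (evalSOP-polyBounded P l K l≤K) (evalSOP-polyBounded P′ l K l≤K)
evalSOP-polyBounded (app P)   l K l≤K = const-polyBounded K (λ n → l≤K (evalSOP P l n))

suc≤2^ : ∀ m → suc m ≤ 2 ^ m
suc≤2^ zero    = ≤-refl
suc≤2^ (suc m) = begin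
  suc (suc m)      ≡⟨ cong suc (+-identityʳ (suc m)) ⟨
  1 + (suc m + 0)  ≤⟨ +-mono-≤ (m^n>0 2 m) (+-monoˡ-≤ 0 (suc≤2^ m)) ⟩
  2 ^ suc m        ∎
  where open ≤-Reasoning

-- The quadratic (m+1)² dominates the linear exponent c + (2m+1)·e for m = c + 2e.
exponent-bound : ∀ c e → let j = (c + 2 * e) + (c + 2 * e) in c + suc j * e ≤ 2 ^ j
exponent-bound c e = begin
  c + suc (m + m) * e                              ≤⟨ m≤m+n _ _ ⟩
  (c + suc (m + m) * e) + (1 + c + 3 * e + c * c + 2 * c * e) ≡⟨ square c e ⟨
  suc m * suc m                                    ≤⟨ *-mono-≤ (suc≤2^ m) (suc≤2^ m) ⟩
  2 ^ m * 2 ^ m                                    ≡⟨ ^-distribˡ-+-* 2 m m ⟨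
  2 ^ (m + m)                                      ∎
  where
  open ≤-Reasoning
  m = c + 2 * e
  square : ∀ c e → suc (c + 2 * e) * suc (c + 2 * e) ≡
    (c + suc ((c + 2 * e) + (c + 2 * e)) * e) + (1 + c + 3 * e + c * c + 2 * c * e)
  square = solve-∀

polynomial<3^ : ∀ c e → Σ ℕ λ n → c * suc n ^ e < 3 ^ n
polynomial<3^ c e = n , (begin-strict
  c * suc n ^ e            ≤⟨ *-monoʳ-≤ c (^-monoˡ-≤ e suc-n≤) ⟩
  c * (2 ^ suc j) ^ e      ≡⟨ cong (c *_) (^-*-assoc 2 (suc j) e) ⟩
  c * 2 ^ (suc j * e)      <⟨ *-monoˡ-< (2 ^ (suc j * e)) {{m^n≢0 2 (suc j * e)}} (suc≤2^ c) ⟩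
  2 ^ c * 2 ^ (suc j * e)  ≡⟨ ^-distribˡ-+-* 2 c (suc j * e) ⟨
  2 ^ (c + suc j * e)      ≤⟨ ^-monoʳ-≤ 2 (exponent-bound c e) ⟩
  2 ^ n                    ≤⟨ ^-monoˡ-≤ n (s≤s (s≤s z≤n)) ⟩
  3 ^ n                    ∎)
  where
  open ≤-Reasoning
  j = (c + 2 * e) + (c + 2 * e)
  n = 2 ^ j
  suc-n≤ : suc n ≤ 2 ^ suc j
  suc-n≤ = ≤-trans (+-monoˡ-≤ n (m^n>0 2 j)) (≤-reflexive (cong (n +_) (sym (+-identityʳ n))))

_≟Sym_ : (x y : Sym) → Dec (x ≡ y)
s0 ≟Sym s0 = yes refl
s0 ≟Sym s1 = no λ ()
s0 ≟Sym s# = no λ ()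
s1 ≟Sym s0 = no λ ()
s1 ≟Sym s1 = yes refl
s1 ≟Sym s# = no λ ()
s# ≟Sym s0 = no λ ()
s# ≟Sym s1 = no λ ()
s# ≟Sym s# = yes refl

spike : Str → Str → Baire
spike b w x with ≡-dec _≟Sym_ x b
... | yes _ = w
... | no  _ = []

spike-at : (b w : Str) → spike b w b ≡ w
spike-at b w with ≡-dec _≟Sym_ b b
... | yes _  = refl
... | no b≢b = ⊥-elim (b≢b refl)

spike-elsewhere : (b w x : Str) → ¬ x ≡ b → spike b w x ≡ []
spike-elsewhere b w x x≢b with ≡-dec _≟Sym_ x b
... | yes x≡b = ⊥-elim (x≢b x≡b)
... | no  _   = refl

module Adversary (F : Baire → Baire) (M : OTM) (P : SOP)
  (computes : (φ : Baire) (a : Str) → HaltsWithin M φ a (evalSOP P (len φ) (length a)) (F φ a)) where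

  empty : Baire
  empty _ = []

  time : Str → ℕ
  time a = evalSOP P (len empty) (length a)

  askedOn : Str → List Str
  askedOn a = queries M empty (time a) (initConf M a)

  asked : ℕ → List Str
  asked n = concatMap askedOn (wordsUpTo n)

  undetected : (φ : Baire) (n : ℕ) → (∀ {x} → x ∈ asked n → φ x ≡ []) →
    ∀ a → length a ≤ n → F φ a ≡ F empty a
  undetected φ n silent a ≤n = halts-unique M φ a (computes φ a) (begin
    run M φ (time a) (initConf M a)      ≡⟨ run-agree M φ empty (time a) _ (λ x∈ → silent (∈-concatMap askedOn a∈ x∈)) ⟩
    run M empty (time a) (initConf M a)  ≡⟨ computes empty a ⟩
    just (F empty a)                     ∎)
    where
    open ≡-Reasoning
    a∈ : a ∈ wordsUpTo n
    a∈ = ∈-wordsUpTo n a ≤n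

  few-asked : (c d n : ℕ) → (∀ m → evalSOP P (len empty) m ≤ c * suc m ^ d) → c * suc n ^ suc d < 3 ^ n →
    length (asked n) < 3 ^ (2 * n)
  few-asked c d n bound small = begin-strict
    length (asked n)                        ≤⟨ length-concatMap askedOn (wordsUpTo n) _ per-input ⟩
    length (wordsUpTo n) * (c * suc n ^ d)  ≤⟨ *-monoˡ-≤ _ (wordsUpTo-size n) ⟩
    (suc n * 3 ^ n) * (c * suc n ^ d)       ≡⟨ regroup (suc n) (3 ^ n) c (suc n ^ d) ⟩
    3 ^ n * (c * suc n ^ suc d)             <⟨ *-monoʳ-< (3 ^ n) {{m^n≢0 3 n}} small ⟩
    3 ^ n * 3 ^ n                           ≡⟨ ^-distribˡ-+-* 3 n n ⟨
    3 ^ (n + n)                             ≡⟨ cong (λ k → 3 ^ (n + k)) (+-identityʳ n) ⟨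
    3 ^ (2 * n)                             ∎
    where
    open ≤-Reasoning
    per-input : ∀ {a} → a ∈ wordsUpTo n → length (askedOn a) ≤ c * suc n ^ d
    per-input {a} a∈ = ≤-trans (queries-length M empty (time a) _)
      (≤-trans (bound (length a)) (*-monoʳ-≤ c (^-monoˡ-≤ d (s≤s (wordsUpTo-length n a∈)))))
    regroup : ∀ s t c p → (s * t) * (c * p) ≡ t * (c * (s * p))
    regroup = solve-∀

  long : ℕ → Str
  long n = replicate (suc (len (F empty) n)) s0

  spikeDefeats : (n : ℕ) (b : Str) → length b ≡ 2 * n → ¬ b ∈ asked n →
    len (F (spike b (long n))) n < len (spike b (long n)) (2 * n)
  spikeDefeats n b |b|≡2n b∉ = begin-strict
    len (F φ) n            ≡⟨ len-cong (F φ) (F empty) n (undetected φ n silent) ⟩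
    len (F empty) n        <⟨ n<1+n _ ⟩
    suc (len (F empty) n)  ≡⟨ length-replicate (suc (len (F empty) n)) ⟨
    length (long n)        ≡⟨ cong length (spike-at b (long n)) ⟨
    length (φ b)           ≤⟨ len-≥ φ (2 * n) b (≤-reflexive |b|≡2n) ⟩
    len φ (2 * n)          ∎
    where
    open ≤-Reasoning
    φ : Baire
    φ = spike b (long n)
    silent : ∀ {x} → x ∈ asked n → φ x ≡ []
    silent {x} x∈ = spike-elsewhere b (long n) x (λ x≡b → b∉ (subst (_∈ asked n) x≡b x∈))

  defeat : Σ Baire λ φ → Σ ℕ λ n → len (F φ) n < len φ (2 * n)
  defeat =
    let c , d , bound   = evalSOP-polyBounded P (len empty) 0 (λ m → ≤-reflexive (len-empty m))
        n , small       = polynomial<3^ c (suc d)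
        b , |b|≡2n , b∉ = avoid (2 * n) (asked n) (few-asked c d n bound small)
    in spike b (long n) , n , spikeDefeats n b |b|≡2n b∉

mainTheorem6 : ¬ (Σ (Baire → Baire) λ F → PolyTimeComputable F × ((φ : Baire) (n : ℕ) → len φ (2 * n) ≤ len (F φ) n))
mainTheorem6 (F , (M , P , computes) , expands) =
  let φ , n , shrinks = Adversary.defeat F M P computes
  in <⇒≱ shrinks (expands φ n)
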